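{- Let $p$ be a prime, $m\ge1$, and let $\alpha\in\mathrm{Aut}(\mathbb{Z}_{p^m})$. Then $$\sum_{\Omega\in\mathrm{Fix}_\alpha}x^{|\Omega|}=\left(\sum_{\Omega\in X_0,\ \alpha(\Omega)=\Omega}x^{|\Omega|}\right)\prod_{k=1}^{m-1}\left(1+\sum_{\Omega\in X_k,\ \alpha(\Omega)=\Omega}x^{|\Omega|}\right).$$
   Context: $\mathbb{Z}_{p^m}$ is the additive cyclic group of order $p^m$; its automorphisms are the maps $s\mapsto us$ with $u$ a unit. For $k=0,1,\dots,m-1$ let $A_k=\{s\in\mathbb{Z}_{p^m}:\gcd(s,p^m)=p^k\}$, and let $X_k$ be the set of nonempty subsets $\Omega\subseteq A_k$ with $-\Omega=\Omega$. Let $G(\mathbb{Z}_{p^m})$ be the set of subsets $\Omega\subseteq\mathbb{Z}_{p^m}$ with $-\Omega=\Omega$, $0\notin\Omega$, and $\Omega$ generating $\mathbb{Z}_{p^m}$, and $\mathrm{Fix}_\alpha=\{\Omega\in G(\mathbb{Z}_{p^m}):\alpha(\Omega)=\Omega\}$. An empty product equals $1$. -}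

module Defs where

open import Data.Nat using (ℕ; zero; suc; _+_; _*_; _∸_; _^_; NonZero)
open import Data.Nat.DivMod using (_%_; m%n<n)
open import Data.Nat.GCD using (gcd)
open import Data.Nat.Properties using (m^n≢0)
import Data.Nat.Properties as ℕP
open import Data.Nat.Primality using (Prime; prime⇒nonZero)
open import Data.Fin using (Fin; toℕ; fromℕ<)
import Data.Fin.Properties as FinP
open import Data.Fin.Subset using (Subset; inside; outside; _∈_; _∉_; _⊆_; Nonempty; ∣_∣)
open import Data.Fin.Subset.Properties using (_∈?_; _⊆?_; nonempty?)
open import Data.Vec using (Vec; []; _∷_; tabulate)
open import Data.Vec.Properties using (≡-dec)
import Data.Bool.Properties as BoolP
open import Data.List using (List; []; _∷_; _++_; map; filter)
open import Data.Nat.ListAction using (sum)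
open import Level using (0ℓ)
open import Data.Product using (_×_; _,_; ∃)
open import Relation.Nullary using (Dec; does; ¬_)
open import Relation.Nullary.Decidable using (_×-dec_; ¬?)
open import Relation.Unary using (Pred; Decidable)
open import Relation.Binary.PropositionalEquality using (_≡_)

allSubsets : (n : ℕ) → List (Subset n)
allSubsets zero = [] ∷ []
allSubsets (suc n) = map (outside ∷_) (allSubsets n) ++ map (inside ∷_) (allSubsets n)

GF : {n : ℕ} (P : Pred (Subset n) 0ℓ) → Decidable P → ℕ → ℕ
GF {n} P P? x = sum (map (λ Ω → x ^ ∣ Ω ∣) (filter P? (allSubsets n)))

module Zpm (p m : ℕ) (pr : Prime p) where

  N : ℕ
  N = p ^ m

  instance
    nzN : NonZero N
    nzN = m^n≢0 p m {{prime⇒nonZero pr}}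

  Z : Set
  Z = Fin N

  [_] : ℕ → Z
  [ k ] = fromℕ< (m%n<n k N)

  0ᶻ : Z
  0ᶻ = [ 0 ]

  _+ᶻ_ : Z → Z → Z
  a +ᶻ b = [ toℕ a + toℕ b ]

  -ᶻ_ : Z → Z
  -ᶻ a = [ N ∸ toℕ a ]

  mulᶻ : ℕ → Z → Z
  mulᶻ u s = [ u * toℕ s ]

  image : (Z → Z) → Subset N → Subset N
  image f Ω = tabulate (λ t → does (FinP.any? (λ s → (s ∈? Ω) ×-dec (f s FinP.≟ t))))

  _≟ˢ_ : (Ω Ω' : Subset N) → Dec (Ω ≡ Ω')
  _≟ˢ_ = ≡-dec BoolP._≟_

  Symmetric : Subset N → Set
  Symmetric Ω = image -ᶻ_ Ω ≡ Ω

  data ⟨_⟩ (Ω : Subset N) : Z → Set where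
    ⟨0⟩   : ⟨ Ω ⟩ 0ᶻ
    ⟨gen⟩ : ∀ {s} → s ∈ Ω → ⟨ Ω ⟩ s
    ⟨+⟩   : ∀ {a b} → ⟨ Ω ⟩ a → ⟨ Ω ⟩ b → ⟨ Ω ⟩ (a +ᶻ b)
    ⟨-⟩   : ∀ {a} → ⟨ Ω ⟩ a → ⟨ Ω ⟩ (-ᶻ a)

  Generates : Subset N → Set
  Generates Ω = ∀ t → ⟨ Ω ⟩ t

  -- Fix_α for α = (s ↦ u s):  Ω ∈ G(ℤ_{p^m}) and α(Ω) = Ω
  FixPred : ℕ → Pred (Subset N) 0ℓ
  FixPred u Ω = Symmetric Ω × 0ᶻ ∉ Ω × Generates Ω × image (mulᶻ u) Ω ≡ Ω

  fix? : (u : ℕ) → Decidable Generates → Decidable (FixPred u)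
  fix? u gen? Ω = (image -ᶻ_ Ω ≟ˢ Ω) ×-dec (¬? (0ᶻ ∈? Ω) ×-dec (gen? Ω ×-dec (image (mulᶻ u) Ω ≟ˢ Ω)))

  A : ℕ → Subset N
  A k = tabulate (λ s → does (gcd (toℕ s) N ℕP.≟ p ^ k))

  XFixPred : ℕ → ℕ → Pred (Subset N) 0ℓ
  XFixPred u k Ω = Nonempty Ω × Ω ⊆ A k × Symmetric Ω × image (mulᶻ u) Ω ≡ Ω

  xfix? : (u k : ℕ) → Decidable (XFixPred u k)
  xfix? u k Ω = nonempty? Ω ×-dec ((Ω ⊆? A k) ×-dec ((image -ᶻ_ Ω ≟ˢ Ω) ×-dec (image (mulᶻ u) Ω ≟ˢ Ω)))

-- Every s ∈ ℤ_{p^m} lies in exactly one A_k with k ≤ m, since gcd(s, p^m) divides p^m, and A_m = {0}.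
-- Negation and multiplication by a unit preserve gcd(s, p^m), so Ω is fixed by them iff every block
-- Ω ∩ A_k is. A set Ω generates ℤ_{p^m} iff it contains a unit (Bézout; otherwise p divides
-- everything Ω generates), i.e. iff Ω ∩ A_0 ≠ ∅, and 0 ∉ Ω iff Ω ∩ A_m = ∅. So Ω ∈ Fix_α iff
-- Ω ∩ A_0 is an α-fixed member of X_0, each Ω ∩ A_k (0 < k < m) is empty or an α-fixed member of X_k,
-- and Ω ⊆ ℤ_{p^m} ∖ {0}. As x^|Ω| = ∏_k x^|Ω ∩ A_k|, the sum over Ω ⊆ ℤ_{p^m} ∖ {0} then factorises
-- into the product over k < m of the sums over the admissible blocks S ⊆ A_k.

module Submission where

open import Defs
open import Data.Bool using (true; false; if_then_else_)
open import Data.Empty using (⊥-elim)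
open import Data.Fin using (Fin; zero; suc; toℕ)
open import Data.Fin.Properties using (toℕ-fromℕ<; toℕ<n; toℕ-injective)
import Data.Fin.Properties as FinP
open import Data.Fin.Subset
  using (Subset; outside; inside; _∈_; _∉_; _⊆_; _∩_; _─_; ⊤; ⊥; ∁; ⁅_⁆; ∣_∣; Nonempty; Empty)
open import Data.Fin.Subset.Properties
  using (_∈?_; nonempty?; x∈⁅x⁆; x∈⁅y⁆⇒x≡y; x∈∁p⇒x∉p; x∉p⇒x∈∁p; out⊆; in⊆in; drop-∷-⊆;
         drop-∷-Empty; Empty-unique; ∣⊥∣≡0; ⊆-antisym; x∈p∩q⁺; x∈p∩q⁻; p∩q⊆p; p∩q⊆q; p─q⊆p;
         x∈p∧x∉q⇒x∈p─q)
open import Data.List using (List; []; _∷_; _++_; map; filter; upTo; applyUpTo)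
open import Data.List.Properties using (map-++; map-∘; map-cong-local; map-upTo)
open import Data.List.Relation.Unary.All as All using (All; []; _∷_)
import Data.List.Relation.Unary.All.Properties as All
open import Data.List.Relation.Unary.Any using (Any; here; there)
open import Data.List.Membership.Propositional using (lose)
open import Data.List.Membership.Propositional.Properties using (∈-upTo⁺; ∈-upTo⁻)
open import Data.List.Relation.Unary.Unique.Propositional using (Unique)
open import Data.List.Relation.Unary.Unique.Propositional.Properties using (upTo⁺)
open import Data.List.Relation.Unary.AllPairs using ([]; _∷_)
open import Data.Nat
  using (ℕ; zero; suc; _+_; _*_; _∸_; _^_; _≤_; _<_; z≤n; s≤s; z<s;
         NonZero; >-nonZero; >-nonZero⁻¹; nonTrivial⇒n>1)
open import Data.Nat.DivMod
  using (_%_; m<n⇒m%n≡m; %-distribˡ-+; m%n%n≡m%n; [m+kn]%n≡m%n; m*n%n≡0; %-pred-≡0)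
open import Data.Nat.Coprimality using (Coprime; coprime-divisor; coprime-Bézout; gcd≡1⇒coprime)
open import Data.Nat.Divisibility
open import Data.Nat.GCD
  using (module Bézout; gcd; gcd[m,n]∣m; gcd[m,n]∣n; gcd-greatest; gcd-identityˡ)
open import Data.Nat.Primality using (Prime; prime⇒nonZero; prime⇒nonTrivial; prime⇒irreducible)
open import Data.Nat.ListAction using (sum; product)
open import Data.Nat.ListAction.Properties using (sum-++)
open import Data.Nat.Properties renaming (_≟_ to _ℕ≟_)
import Algebra.Properties.CommutativeSemigroup as CommutativeSemigroupProperties
open CommutativeSemigroupProperties +-commutativeSemigroup using (interchange)
open CommutativeSemigroupProperties *-commutativeSemigroup using (x∙yz≈y∙xz)
open import Data.Product using (_×_; _,_; ∃; proj₁; proj₂)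
open import Data.Sum using (_⊎_; inj₁; inj₂)
open import Data.Vec using ([]; _∷_; here; there; tabulate)
open import Data.Vec.Properties using (lookup∘tabulate; []=⇒lookup; lookup⇒[]=)
open import Function using (_∘_; case_of_; _⇔_; mk⇔; Equivalence)
open import Level using (0ℓ)
open import Relation.Nullary using (Dec; yes; no; does; ¬_; contradiction; _×-dec_; _⊎-dec_)
open import Relation.Nullary.Decidable using (does-⇔; dec-true; ¬?)
open import Relation.Unary using (Pred; Decidable)
open import Relation.Binary.PropositionalEquality hiding ([_])

private variable n : ℕ

𝟙 : {P : Set} → Dec P → ℕ
𝟙 P? = if does P? then 1 else 0

𝟙-⇔ : {P Q : Set} → P ⇔ Q → (P? : Dec P) (Q? : Dec Q) → 𝟙 P? ≡ 𝟙 Q?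
𝟙-⇔ P⇔Q P? Q? = cong (λ b → if b then 1 else 0) (does-⇔ P⇔Q P? Q?)

𝟙-yes : {P : Set} (P? : Dec P) → P → 𝟙 P? ≡ 1
𝟙-yes (yes _) _ = refl
𝟙-yes (no ¬p) p = ⊥-elim (¬p p)

𝟙-no : {P : Set} (P? : Dec P) → ¬ P → 𝟙 P? ≡ 0
𝟙-no (yes p) ¬p = ⊥-elim (¬p p)
𝟙-no (no _) _ = refl

𝟙-⊎ : {P Q : Set} (P? : Dec P) (Q? : Dec Q) → ¬ (P × Q) → 𝟙 (P? ⊎-dec Q?) ≡ 𝟙 P? + 𝟙 Q?
𝟙-⊎ (yes p) (yes q) ¬pq = ⊥-elim (¬pq (p , q))
𝟙-⊎ (yes _) (no _) _ = refl
𝟙-⊎ (no _) (yes _) _ = refl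
𝟙-⊎ (no _) (no _) _ = refl

product-𝟙-All : {A : Set} {P : Set} {Q : Pred A 0ℓ} (P? : Dec P) (Q? : Decidable Q) (ks : List A) →
                P ⇔ All Q ks → product (map (λ k → 𝟙 (Q? k)) ks) ≡ 𝟙 P?
product-𝟙-All P? Q? [] P⇔ = sym (𝟙-yes P? (Equivalence.from P⇔ []))
product-𝟙-All P? Q? (k ∷ ks) P⇔ with Q? k
... | yes q = trans (+-identityʳ _)
                (product-𝟙-All P? Q? ks (mk⇔ (All.tail ∘ Equivalence.to P⇔) (Equivalence.from P⇔ ∘ (q ∷_))))
... | no ¬q = sym (𝟙-no P? (¬q ∘ All.head ∘ Equivalence.to P⇔))

product-map-* : {A : Set} (f g : A → ℕ) (ks : List A) →
                product (map (λ k → f k * g k) ks) ≡ product (map f ks) * product (map g ks)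
product-map-* f g [] = refl
product-map-* f g (k ∷ ks) = begin
  f k * g k * ∏ (λ k → f k * g k) ≡⟨ cong (f k * g k *_) (product-map-* f g ks) ⟩
  f k * g k * (∏ f * ∏ g)         ≡⟨ *-assoc (f k) (g k) _ ⟩
  f k * (g k * (∏ f * ∏ g))       ≡⟨ cong (f k *_) (x∙yz≈y∙xz (g k) (∏ f) (∏ g)) ⟩
  f k * (∏ f * (g k * ∏ g))       ≡⟨ *-assoc (f k) _ _ ⟨
  f k * ∏ f * (g k * ∏ g)         ∎
  where
  open ≡-Reasoning
  ∏ : (_ → ℕ) → ℕ
  ∏ h = product (map h ks)

product-map-^ : {A : Set} (x : ℕ) (e : A → ℕ) (ks : List A) →
                product (map (λ k → x ^ e k) ks) ≡ x ^ sum (map e ks)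
product-map-^ x e [] = refl
product-map-^ x e (k ∷ ks) =
  trans (cong (x ^ e k *_) (product-map-^ x e ks)) (sym (^-distribˡ-+-* x (e k) _))

∑⊆ : Subset n → (Subset n → ℕ) → ℕ
∑⊆ [] f = f []
∑⊆ (outside ∷ T) f = ∑⊆ T (f ∘ (outside ∷_))
∑⊆ (inside ∷ T) f = ∑⊆ T (f ∘ (outside ∷_)) + ∑⊆ T (f ∘ (inside ∷_))

syntax ∑⊆ T (λ Ω → e) = ∑[ Ω ⊆ T ] e

∑⊆-cong : (T : Subset n) {f g : Subset n → ℕ} → (∀ {Ω} → Ω ⊆ T → f Ω ≡ g Ω) →
          ∑⊆ T f ≡ ∑⊆ T g
∑⊆-cong [] f≗g = f≗g (λ ())
∑⊆-cong (outside ∷ T) f≗g = ∑⊆-cong T (f≗g ∘ out⊆)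
∑⊆-cong (inside ∷ T) f≗g = cong₂ _+_ (∑⊆-cong T (f≗g ∘ out⊆)) (∑⊆-cong T (f≗g ∘ in⊆in))

∑⊆-+ : (T : Subset n) (f g : Subset n → ℕ) → ∑[ Ω ⊆ T ] (f Ω + g Ω) ≡ ∑⊆ T f + ∑⊆ T g
∑⊆-+ [] f g = refl
∑⊆-+ (outside ∷ T) f g = ∑⊆-+ T (f ∘ (outside ∷_)) (g ∘ (outside ∷_))
∑⊆-+ (inside ∷ T) f g =
  trans (cong₂ _+_ (∑⊆-+ T (f ∘ (outside ∷_)) (g ∘ (outside ∷_)))
                   (∑⊆-+ T (f ∘ (inside ∷_)) (g ∘ (inside ∷_))))
        (interchange (∑⊆ T (f ∘ (outside ∷_))) (∑⊆ T (g ∘ (outside ∷_)))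
                     (∑⊆ T (f ∘ (inside ∷_))) (∑⊆ T (g ∘ (inside ∷_))))

∑⊆-zero : (T : Subset n) (f : Subset n → ℕ) → (∀ Ω → f Ω ≡ 0) → ∑⊆ T f ≡ 0
∑⊆-zero [] f f≡0 = f≡0 []
∑⊆-zero (outside ∷ T) f f≡0 = ∑⊆-zero T _ (f≡0 ∘ (outside ∷_))
∑⊆-zero (inside ∷ T) f f≡0 =
  cong₂ _+_ (∑⊆-zero T _ (f≡0 ∘ (outside ∷_))) (∑⊆-zero T _ (f≡0 ∘ (inside ∷_)))

∑⊆-⊥ : (n : ℕ) (f : Subset n → ℕ) → ∑⊆ ⊥ f ≡ f ⊥
∑⊆-⊥ zero f = refl
∑⊆-⊥ (suc n) f = ∑⊆-⊥ n (f ∘ (outside ∷_))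

∑⊆-∩─ : (T S : Subset n) (f g : Subset n → ℕ) →
        ∑[ Ω ⊆ T ] (f (Ω ∩ S) * g (Ω ─ S)) ≡ ∑⊆ (T ∩ S) f * ∑⊆ (T ─ S) g
∑⊆-∩─ [] [] f g = refl
∑⊆-∩─ (outside ∷ T) (inside ∷ S) f g = ∑⊆-∩─ T S (f ∘ (outside ∷_)) (g ∘ (outside ∷_))
∑⊆-∩─ (outside ∷ T) (outside ∷ S) f g = ∑⊆-∩─ T S (f ∘ (outside ∷_)) (g ∘ (outside ∷_))
∑⊆-∩─ (inside ∷ T) (inside ∷ S) f g =
  trans (cong₂ _+_ (∑⊆-∩─ T S (f ∘ (outside ∷_)) (g ∘ (outside ∷_)))
                   (∑⊆-∩─ T S (f ∘ (inside ∷_)) (g ∘ (outside ∷_))))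
        (sym (*-distribʳ-+ (∑⊆ (T ─ S) (g ∘ (outside ∷_))) (∑⊆ (T ∩ S) (f ∘ (outside ∷_))) _))
∑⊆-∩─ (inside ∷ T) (outside ∷ S) f g =
  trans (cong₂ _+_ (∑⊆-∩─ T S (f ∘ (outside ∷_)) (g ∘ (outside ∷_)))
                   (∑⊆-∩─ T S (f ∘ (outside ∷_)) (g ∘ (inside ∷_))))
        (sym (*-distribˡ-+ (∑⊆ (T ∩ S) (f ∘ (outside ∷_))) (∑⊆ (T ─ S) (g ∘ (outside ∷_))) _))

∑⊆≡∑⊆⊤ : (S : Subset n) (f : Subset n → ℕ) → (∀ Ω → ¬ Ω ⊆ S → f Ω ≡ 0) → ∑⊆ S f ≡ ∑⊆ ⊤ f
∑⊆≡∑⊆⊤ [] f _ = refl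
∑⊆≡∑⊆⊤ (inside ∷ S) f f≡0 =
  cong₂ _+_ (∑⊆≡∑⊆⊤ S (f ∘ (outside ∷_)) (λ Ω Ω⊈S → f≡0 _ (Ω⊈S ∘ drop-∷-⊆)))
            (∑⊆≡∑⊆⊤ S (f ∘ (inside ∷_)) (λ Ω Ω⊈S → f≡0 _ (Ω⊈S ∘ drop-∷-⊆)))
∑⊆≡∑⊆⊤ (outside ∷ S) f f≡0 = begin
  ∑⊆ S (f ∘ (outside ∷_))
    ≡⟨ ∑⊆≡∑⊆⊤ S (f ∘ (outside ∷_)) (λ Ω Ω⊈S → f≡0 _ (Ω⊈S ∘ drop-∷-⊆)) ⟩
  ∑⊆ ⊤ (f ∘ (outside ∷_))
    ≡⟨ +-identityʳ _ ⟨
  ∑⊆ ⊤ (f ∘ (outside ∷_)) + 0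
    ≡⟨ cong (∑⊆ ⊤ (f ∘ (outside ∷_)) +_) (∑⊆-zero ⊤ (f ∘ (inside ∷_)) (λ _ → f≡0 _ inside∷⊈outside∷)) ⟨
  ∑⊆ ⊤ (f ∘ (outside ∷_)) + ∑⊆ ⊤ (f ∘ (inside ∷_)) ∎
  where
  open ≡-Reasoning
  inside∷⊈outside∷ : ∀ {Ω} → ¬ (inside ∷ Ω) ⊆ (outside ∷ S)
  inside∷⊈outside∷ sub with sub here
  ... | ()

empty? : Decidable (Empty {n})
empty? S = ¬? (nonempty? S)

Empty-outside∷ : {S : Subset n} → Empty (outside ∷ S) ⇔ Empty S
Empty-outside∷ = mk⇔ drop-∷-Empty (λ ∅S → λ { (zero , ()) ; (suc x , there x∈S) → ∅S (x , x∈S) })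

𝟙-Empty-outside∷ : (S : Subset n) → 𝟙 (empty? (outside ∷ S)) ≡ 𝟙 (empty? S)
𝟙-Empty-outside∷ S = 𝟙-⇔ Empty-outside∷ (empty? (outside ∷ S)) (empty? S)

𝟙-Empty-inside∷ : (S : Subset n) → 𝟙 (empty? (inside ∷ S)) ≡ 0
𝟙-Empty-inside∷ S = 𝟙-no (empty? (inside ∷ S)) (λ ∅S → ∅S (zero , here))

∑⊆-𝟙-Empty : (T : Subset n) (g : Subset n → ℕ) → ∑[ S ⊆ T ] (𝟙 (empty? S) * g S) ≡ g ⊥
∑⊆-𝟙-Empty [] g = +-identityʳ (g [])
∑⊆-𝟙-Empty (outside ∷ T) g =
  trans (∑⊆-cong T (λ {S} _ → cong (_* g (outside ∷ S)) (𝟙-Empty-outside∷ S)))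
        (∑⊆-𝟙-Empty T (g ∘ (outside ∷_)))
∑⊆-𝟙-Empty (inside ∷ T) g =
  trans (cong₂ _+_
          (trans (∑⊆-cong T (λ {S} _ → cong (_* g (outside ∷ S)) (𝟙-Empty-outside∷ S)))
                 (∑⊆-𝟙-Empty T (g ∘ (outside ∷_))))
          (∑⊆-zero T _ (λ S → cong (_* g (inside ∷ S)) (𝟙-Empty-inside∷ S))))
        (+-identityʳ (g ⊥))

∣∣-∩─ : (Ω S : Subset n) → ∣ Ω ∣ ≡ ∣ Ω ∩ S ∣ + ∣ Ω ─ S ∣
∣∣-∩─ [] [] = refl
∣∣-∩─ (outside ∷ Ω) (inside ∷ S) = ∣∣-∩─ Ω S
∣∣-∩─ (outside ∷ Ω) (outside ∷ S) = ∣∣-∩─ Ω S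
∣∣-∩─ (inside ∷ Ω) (inside ∷ S) = cong suc (∣∣-∩─ Ω S)
∣∣-∩─ (inside ∷ Ω) (outside ∷ S) = trans (cong suc (∣∣-∩─ Ω S)) (sym (+-suc _ _))

sum-map-filter : {A : Set} {P : Pred A 0ℓ} (P? : Decidable P) (h : A → ℕ) (xs : List A) →
                 sum (map h (filter P? xs)) ≡ sum (map (λ a → 𝟙 (P? a) * h a) xs)
sum-map-filter P? h [] = refl
sum-map-filter P? h (a ∷ xs) with does (P? a)
... | false = sum-map-filter P? h xs
... | true = cong₂ _+_ (sym (+-identityʳ (h a))) (sum-map-filter P? h xs)

sum-map-allSubsets : (n : ℕ) (h : Subset n → ℕ) → sum (map h (allSubsets n)) ≡ ∑⊆ ⊤ h
sum-map-allSubsets zero h = +-identityʳ (h [])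
sum-map-allSubsets (suc n) h = begin
  sum (map h (map (outside ∷_) Ωs ++ map (inside ∷_) Ωs))
    ≡⟨ cong sum (map-++ h (map (outside ∷_) Ωs) _) ⟩
  sum (map h (map (outside ∷_) Ωs) ++ map h (map (inside ∷_) Ωs))
    ≡⟨ sum-++ (map h (map (outside ∷_) Ωs)) _ ⟩
  sum (map h (map (outside ∷_) Ωs)) + sum (map h (map (inside ∷_) Ωs))
    ≡⟨ cong₂ _+_ (cong sum (map-∘ Ωs)) (cong sum (map-∘ Ωs)) ⟨
  sum (map (h ∘ (outside ∷_)) Ωs) + sum (map (h ∘ (inside ∷_)) Ωs)
    ≡⟨ cong₂ _+_ (sum-map-allSubsets n _) (sum-map-allSubsets n _) ⟩
  ∑⊆ ⊤ (h ∘ (outside ∷_)) + ∑⊆ ⊤ (h ∘ (inside ∷_)) ∎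
  where
  open ≡-Reasoning
  Ωs = allSubsets n

GF≡∑⊆ : {P : Pred (Subset n) 0ℓ} (P? : Decidable P) (x : ℕ) →
        GF P P? x ≡ ∑[ Ω ⊆ ⊤ ] (𝟙 (P? Ω) * x ^ ∣ Ω ∣)
GF≡∑⊆ {n} P? x = trans (sum-map-filter P? (λ Ω → x ^ ∣ Ω ∣) (allSubsets n)) (sum-map-allSubsets n _)

x∈p─q⇒x∉q : {x : Fin n} (p q : Subset n) → x ∈ p ─ q → x ∉ q
x∈p─q⇒x∉q (_ ∷ p) (inside ∷ q) () here
x∈p─q⇒x∉q (_ ∷ p) (_ ∷ q) (there x∈p─q) (there x∈q) = x∈p─q⇒x∉q p q x∈p─q x∈q

module Partition {n : ℕ} (A : ℕ → Subset n) (A-disjoint : ∀ {i k s} → s ∈ A i → s ∈ A k → i ≡ k) where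

  Covers : Subset n → List ℕ → Set
  Covers T ks = ∀ {s} → s ∈ T → Any (λ k → s ∈ A k) ks

  Covers-[] : {T : Subset n} → Covers T [] → T ≡ ⊥
  Covers-[] cover = Empty-unique (λ (_ , s∈T) → case cover s∈T of λ ())

  Covers-─ : {T : Subset n} {k : ℕ} {ks : List ℕ} → Covers T (k ∷ ks) → Covers (T ─ A k) ks
  Covers-─ {T} {k} cover s∈T─Ak with cover (p─q⊆p T (A k) s∈T─Ak)
  ... | here s∈Ak = ⊥-elim (x∈p─q⇒x∉q T (A k) s∈T─Ak s∈Ak)
  ... | there s∈Aks = s∈Aks

  ─∩-disjoint : {i k : ℕ} (Ω : Subset n) → i ≢ k → (Ω ─ A i) ∩ A k ≡ Ω ∩ A k
  ─∩-disjoint {i} {k} Ω i≢k = ⊆-antisym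
    (λ s∈ → let s∈Ω─Ai , s∈Ak = x∈p∩q⁻ _ _ s∈ in x∈p∩q⁺ (p─q⊆p Ω (A i) s∈Ω─Ai , s∈Ak))
    (λ s∈ → let s∈Ω , s∈Ak = x∈p∩q⁻ _ _ s∈ in
            x∈p∩q⁺ (x∈p∧x∉q⇒x∈p─q s∈Ω (λ s∈Ai → i≢k (A-disjoint s∈Ai s∈Ak)) , s∈Ak))

  map-─∩-disjoint : {B : Set} (F : ℕ → Subset n → B) (Ω : Subset n) {k : ℕ} {ks : List ℕ} →
                    All (k ≢_) ks → map (λ j → F j ((Ω ─ A k) ∩ A j)) ks ≡ map (λ j → F j (Ω ∩ A j)) ks
  map-─∩-disjoint F Ω k∉ks = map-cong-local (All.map (λ k≢j → cong (F _) (─∩-disjoint Ω k≢j)) k∉ks)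

  ∑⊆-product : {T : Subset n} {ks : List ℕ} → Unique ks → Covers T ks → (φ : ℕ → Subset n → ℕ) →
               ∑[ Ω ⊆ T ] product (map (λ k → φ k (Ω ∩ A k)) ks)
                 ≡ product (map (λ k → ∑⊆ (T ∩ A k) (φ k)) ks)
  ∑⊆-product {T} {[]} [] cover φ = trans (cong (λ T → ∑⊆ T (λ _ → 1)) (Covers-[] cover)) (∑⊆-⊥ n _)
  ∑⊆-product {T} {k ∷ ks} (k∉ks ∷ ks-unique) cover φ = begin
    ∑[ Ω ⊆ T ] (φ k (Ω ∩ A k) * ∏ (λ j → φ j (Ω ∩ A j)))
      ≡⟨ ∑⊆-cong T (λ {Ω} _ → cong (φ k (Ω ∩ A k) *_) (cong product (map-─∩-disjoint φ Ω k∉ks))) ⟨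
    ∑[ Ω ⊆ T ] (φ k (Ω ∩ A k) * ∏ (λ j → φ j ((Ω ─ A k) ∩ A j)))
      ≡⟨ ∑⊆-∩─ T (A k) (φ k) (λ Ω → ∏ (λ j → φ j (Ω ∩ A j))) ⟩
    ∑⊆ (T ∩ A k) (φ k) * ∑[ Ω ⊆ T ─ A k ] ∏ (λ j → φ j (Ω ∩ A j))
      ≡⟨ cong (∑⊆ (T ∩ A k) (φ k) *_) (∑⊆-product ks-unique (Covers-─ cover) φ) ⟩
    ∑⊆ (T ∩ A k) (φ k) * ∏ (λ j → ∑⊆ ((T ─ A k) ∩ A j) (φ j))
      ≡⟨ cong (∑⊆ (T ∩ A k) (φ k) *_) (cong product (map-─∩-disjoint (λ j S → ∑⊆ S (φ j)) T k∉ks)) ⟩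
    ∑⊆ (T ∩ A k) (φ k) * ∏ (λ j → ∑⊆ (T ∩ A j) (φ j)) ∎
    where
    open ≡-Reasoning
    ∏ : (ℕ → ℕ) → ℕ
    ∏ F = product (map F ks)

  ∣∣-sum : {Ω : Subset n} {ks : List ℕ} → Unique ks → Covers Ω ks →
           ∣ Ω ∣ ≡ sum (map (λ k → ∣ Ω ∩ A k ∣) ks)
  ∣∣-sum {Ω} {[]} [] cover = trans (cong ∣_∣ (Covers-[] cover)) (∣⊥∣≡0 n)
  ∣∣-sum {Ω} {k ∷ ks} (k∉ks ∷ ks-unique) cover = begin
    ∣ Ω ∣
      ≡⟨ ∣∣-∩─ Ω (A k) ⟩
    ∣ Ω ∩ A k ∣ + ∣ Ω ─ A k ∣
      ≡⟨ cong (∣ Ω ∩ A k ∣ +_) (∣∣-sum ks-unique (Covers-─ cover)) ⟩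
    ∣ Ω ∩ A k ∣ + sum (map (λ j → ∣ (Ω ─ A k) ∩ A j ∣) ks)
      ≡⟨ cong (λ l → ∣ Ω ∩ A k ∣ + sum l) (map-─∩-disjoint (λ _ → ∣_∣) Ω k∉ks) ⟩
    ∣ Ω ∩ A k ∣ + sum (map (λ j → ∣ Ω ∩ A j ∣) ks) ∎
    where open ≡-Reasoning

  GF-factorisation : {T : Subset n} {ks : List ℕ} → Unique ks → Covers T ks →
                 {P : Pred (Subset n) 0ℓ} (P? : Decidable P)
                 {B : ℕ → Pred (Subset n) 0ℓ} (B? : ∀ k → Decidable (B k)) →
                 (∀ {Ω} → Ω ⊆ T → P Ω ⇔ All (λ k → B k (Ω ∩ A k)) ks) → (x : ℕ) →
                 ∑[ Ω ⊆ T ] (𝟙 (P? Ω) * x ^ ∣ Ω ∣)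
                   ≡ product (map (λ k → ∑[ S ⊆ T ∩ A k ] (𝟙 (B? k S) * x ^ ∣ S ∣)) ks)
  GF-factorisation {T} {ks} ks-unique cover P? B? P⇔blocks x =
    trans (∑⊆-cong T (sym ∘ pointwise))
          (∑⊆-product ks-unique cover (λ k S → 𝟙 (B? k S) * x ^ ∣ S ∣))
    where
    pointwise : ∀ {Ω} → Ω ⊆ T →
                product (map (λ k → 𝟙 (B? k (Ω ∩ A k)) * x ^ ∣ Ω ∩ A k ∣) ks) ≡ 𝟙 (P? Ω) * x ^ ∣ Ω ∣
    pointwise {Ω} Ω⊆T = begin
      product (map (λ k → 𝟙 (B? k (Ω ∩ A k)) * x ^ ∣ Ω ∩ A k ∣) ks)
        ≡⟨ product-map-* _ _ ks ⟩
      product (map (λ k → 𝟙 (B? k (Ω ∩ A k))) ks) * product (map (λ k → x ^ ∣ Ω ∩ A k ∣) ks)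
        ≡⟨ cong₂ _*_ (product-𝟙-All (P? Ω) (λ k → B? k (Ω ∩ A k)) ks (P⇔blocks Ω⊆T))
                     (product-map-^ x (λ k → ∣ Ω ∩ A k ∣) ks) ⟩
      𝟙 (P? Ω) * x ^ sum (map (λ k → ∣ Ω ∩ A k ∣) ks)
        ≡⟨ cong (λ e → 𝟙 (P? Ω) * x ^ e) (∣∣-sum ks-unique (cover ∘ Ω⊆T)) ⟨
      𝟙 (P? Ω) * x ^ ∣ Ω ∣ ∎
      where open ≡-Reasoning

module _ {p : ℕ} (pr : Prime p) where

  instance
    p≢0 : NonZero p
    p≢0 = prime⇒nonZero pr

  1<p : 1 < p
  1<p = nonTrivial⇒n>1 p {{prime⇒nonTrivial pr}}

  ¬∣⇒coprime : ∀ {d} → ¬ p ∣ d → Coprime d p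
  ¬∣⇒coprime p∤d (e∣d , e∣p) with prime⇒irreducible pr e∣p
  ... | inj₁ e≡1 = e≡1
  ... | inj₂ refl = ⊥-elim (p∤d e∣d)

  ∣p^k⇒≡p^j : ∀ k {d} → d ∣ p ^ k → ∃ λ j → j ≤ k × d ≡ p ^ j
  ∣p^k⇒≡p^j zero d∣1 = 0 , z≤n , ∣1⇒≡1 d∣1
  ∣p^k⇒≡p^j (suc k) {d} d∣p^[1+k] with p ∣? d
  ... | yes (divides q refl)
    with ∣p^k⇒≡p^j k {q} (*-cancelʳ-∣ p (subst (q * p ∣_) (*-comm p (p ^ k)) d∣p^[1+k]))
  ...   | j , j≤k , refl = suc j , s≤s j≤k , *-comm (p ^ j) p
  ∣p^k⇒≡p^j (suc k) {d} d∣p^[1+k] | no p∤d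
    with ∣p^k⇒≡p^j k (coprime-divisor (¬∣⇒coprime p∤d) d∣p^[1+k])
  ... | j , j≤k , d≡p^j = j , m≤n⇒m≤1+n j≤k , d≡p^j

^-injectiveʳ : ∀ {b} → 1 < b → ∀ i k → b ^ i ≡ b ^ k → i ≡ k
^-injectiveʳ 1<b zero zero _ = refl
^-injectiveʳ {b} 1<b zero (suc k) 1≡b^[1+k] with m^n≡1⇒n≡0∨m≡1 b (suc k) (sym 1≡b^[1+k])
... | inj₂ refl = contradiction 1<b (<-irrefl refl)
^-injectiveʳ {b} 1<b (suc i) zero b^[1+i]≡1 with m^n≡1⇒n≡0∨m≡1 b (suc i) b^[1+i]≡1
... | inj₂ refl = contradiction 1<b (<-irrefl refl)
^-injectiveʳ {b} 1<b (suc i) (suc k) eq =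
  cong suc (^-injectiveʳ 1<b i k (*-cancelˡ-≡ (b ^ i) (b ^ k) b {{>-nonZero (<-trans z<s 1<b)}} eq))

gcd-cong-∣ : ∀ a b N → (∀ {d} → d ∣ N → d ∣ a → d ∣ b) → (∀ {d} → d ∣ N → d ∣ b → d ∣ a) →
             gcd a N ≡ gcd b N
gcd-cong-∣ a b N a⇒b b⇒a = ∣-antisym
  (gcd-greatest (a⇒b (gcd[m,n]∣n a N) (gcd[m,n]∣m a N)) (gcd[m,n]∣n a N))
  (gcd-greatest (b⇒a (gcd[m,n]∣n b N) (gcd[m,n]∣m b N)) (gcd[m,n]∣n b N))

∣m∣n⇒∣n∸m : ∀ {d m n} → m ≤ n → d ∣ m → d ∣ n → d ∣ n ∸ m
∣m∣n⇒∣n∸m m≤n d∣m d∣n = ∣m+n∣m⇒∣n (subst (_ ∣_) (sym (m+[n∸m]≡n m≤n)) d∣n) d∣m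

∣n∣n∸m⇒∣m : ∀ {d m n} → m ≤ n → d ∣ n → d ∣ n ∸ m → d ∣ m
∣n∣n∸m⇒∣m m≤n d∣n d∣n∸m = ∣m+n∣m⇒∣n (subst (_ ∣_) (sym (m∸n+n≡m m≤n)) d∣n) d∣n∸m

does≡true⇒ : {P : Set} (P? : Dec P) → does P? ≡ true → P
does≡true⇒ (yes p) _ = p

∈-tabulate-does : {P : Pred (Fin n) 0ℓ} (P? : Decidable P) {i : Fin n} → i ∈ tabulate (λ j → does (P? j)) ⇔ P i
∈-tabulate-does P? {i} = mk⇔
  (λ i∈ → does≡true⇒ (P? i) (trans (sym (lookup∘tabulate (λ j → does (P? j)) i)) ([]=⇒lookup i∈)))
  (λ Pi → lookup⇒[]= i _ (trans (lookup∘tabulate (λ j → does (P? j)) i) (dec-true (P? i) Pi)))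

module _ (p m : ℕ) (pr : Prime p) where
  open Zpm p m pr

  toℕ-[] : ∀ k → toℕ [ k ] ≡ k % N
  toℕ-[] k = toℕ-fromℕ< _

  toℕ-0ᶻ : toℕ 0ᶻ ≡ 0
  toℕ-0ᶻ = trans (toℕ-[] 0) (m<n⇒m%n≡m (>-nonZero⁻¹ N))

  gcdᴺ : Z → ℕ
  gcdᴺ s = gcd (toℕ s) N

  ∈A⇔ : ∀ k {s} → s ∈ A k ⇔ gcdᴺ s ≡ p ^ k
  ∈A⇔ k = ∈-tabulate-does (λ s → gcdᴺ s ℕ≟ p ^ k)

  A-disjoint : ∀ {i k s} → s ∈ A i → s ∈ A k → i ≡ k
  A-disjoint {i} {k} s∈Ai s∈Ak =
    ^-injectiveʳ (1<p pr) i k (trans (sym (Equivalence.to (∈A⇔ i) s∈Ai)) (Equivalence.to (∈A⇔ k) s∈Ak))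

  ∃∈A : ∀ s → ∃ λ k → k ≤ m × s ∈ A k
  ∃∈A s with ∣p^k⇒≡p^j pr m (gcd[m,n]∣n (toℕ s) N)
  ... | k , k≤m , gcd≡p^k = k , k≤m , Equivalence.from (∈A⇔ k) gcd≡p^k

  0ᶻ∈A[m] : 0ᶻ ∈ A m
  0ᶻ∈A[m] = Equivalence.from (∈A⇔ m) (trans (cong (λ a → gcd a N) toℕ-0ᶻ) (gcd-identityˡ N))

  ∈A[m]⇒≡0ᶻ : ∀ {s} → s ∈ A m → s ≡ 0ᶻ
  ∈A[m]⇒≡0ᶻ {s} s∈Am = toℕ-injective (trans (m<n∧n∣m⇒m≡0 (toℕ<n s) N∣s) (sym toℕ-0ᶻ))
    where
    N∣s : N ∣ toℕ s
    N∣s = subst (_∣ toℕ s) (Equivalence.to (∈A⇔ m) s∈Am) (gcd[m,n]∣m (toℕ s) N)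
    m<n∧n∣m⇒m≡0 : ∀ {a} → a < N → N ∣ a → a ≡ 0
    m<n∧n∣m⇒m≡0 {zero} _ _ = refl
    m<n∧n∣m⇒m≡0 {suc a} a<N N∣a = contradiction N∣a (>⇒∤ a<N)

  ∈A-resp-gcdᴺ : ∀ k {s t} → gcdᴺ s ≡ gcdᴺ t → s ∈ A k → t ∈ A k
  ∈A-resp-gcdᴺ k s≡t s∈Ak = Equivalence.from (∈A⇔ k) (trans (sym s≡t) (Equivalence.to (∈A⇔ k) s∈Ak))

  gcdᴺ-neg : ∀ s → gcdᴺ (-ᶻ s) ≡ gcdᴺ s
  gcdᴺ-neg s = sym (gcd-cong-∣ (toℕ s) (toℕ (-ᶻ s)) N
    (λ d∣N d∣s → subst (_ ∣_) (sym (toℕ-[] (N ∸ toℕ s)))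
                   (%-presˡ-∣ (∣m∣n⇒∣n∸m s≤N d∣s d∣N) d∣N))
    (λ d∣N d∣-s → ∣n∣n∸m⇒∣m s≤N d∣N
                    (∣n∣m%n⇒∣m d∣N (subst (_ ∣_) (toℕ-[] (N ∸ toℕ s)) d∣-s))))
    where
    s≤N : toℕ s ≤ N
    s≤N = <⇒≤ (toℕ<n s)

  gcdᴺ-mul : ∀ {u} → Coprime u N → ∀ s → gcdᴺ (mulᶻ u s) ≡ gcdᴺ s
  gcdᴺ-mul {u} u⊥N s = sym (gcd-cong-∣ (toℕ s) (toℕ (mulᶻ u s)) N
    (λ d∣N d∣s → subst (_ ∣_) (sym (toℕ-[] (u * toℕ s))) (%-presˡ-∣ (∣n⇒∣m*n u d∣s) d∣N))
    (λ d∣N d∣us → coprime-divisor (λ (e∣d , e∣u) → u⊥N (e∣u , ∣-trans e∣d d∣N))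
                    (∣n∣m%n⇒∣m d∣N (subst (_ ∣_) (toℕ-[] (u * toℕ s)) d∣us))))

  ∈-image⇔ : ∀ {f Ω t} → t ∈ image f Ω ⇔ ∃ λ s → s ∈ Ω × f s ≡ t
  ∈-image⇔ {f} {Ω} = ∈-tabulate-does (λ t → FinP.any? (λ s → (s ∈? Ω) ×-dec (f s FinP.≟ t)))

  ∈-image⁺ : ∀ {f Ω s} → s ∈ Ω → f s ∈ image f Ω
  ∈-image⁺ s∈Ω = Equivalence.from ∈-image⇔ (_ , s∈Ω , refl)

  ∈-image⁻ : ∀ {f Ω t} → t ∈ image f Ω → ∃ λ s → s ∈ Ω × f s ≡ t
  ∈-image⁻ = Equivalence.to ∈-image⇔

  image-Empty : ∀ {f S} → Empty S → image f S ≡ S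
  image-Empty ∅S = ⊆-antisym
    (λ t∈fS → let s , s∈S , _ = ∈-image⁻ t∈fS in ⊥-elim (∅S (s , s∈S)))
    (λ t∈S → ⊥-elim (∅S (_ , t∈S)))

  image-fixed-∩A : ∀ {f Ω} → (∀ s → gcdᴺ (f s) ≡ gcdᴺ s) → image f Ω ≡ Ω →
                   ∀ k → image f (Ω ∩ A k) ≡ Ω ∩ A k
  image-fixed-∩A {f} {Ω} gcd-inv fΩ≡Ω k = ⊆-antisym ⊆Ω∩Ak ⊇Ω∩Ak
    where
    ⊆Ω∩Ak : image f (Ω ∩ A k) ⊆ Ω ∩ A k
    ⊆Ω∩Ak t∈ with ∈-image⁻ t∈
    ... | s , s∈Ω∩Ak , refl = let s∈Ω , s∈Ak = x∈p∩q⁻ Ω (A k) s∈Ω∩Ak in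
      x∈p∩q⁺ (subst (f s ∈_) fΩ≡Ω (∈-image⁺ s∈Ω) , ∈A-resp-gcdᴺ k (sym (gcd-inv s)) s∈Ak)
    ⊇Ω∩Ak : Ω ∩ A k ⊆ image f (Ω ∩ A k)
    ⊇Ω∩Ak t∈ with x∈p∩q⁻ Ω (A k) t∈
    ... | t∈Ω , t∈Ak with ∈-image⁻ (subst (_ ∈_) (sym fΩ≡Ω) t∈Ω)
    ...   | s , s∈Ω , refl = ∈-image⁺ (x∈p∩q⁺ (s∈Ω , ∈A-resp-gcdᴺ k (gcd-inv s) t∈Ak))

  image-fixed-glue : ∀ {f Ω} → (∀ {s} → s ∈ Ω → ∃ λ B → s ∈ B × image f (Ω ∩ B) ≡ Ω ∩ B) →
                     image f Ω ≡ Ω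
  image-fixed-glue {f} {Ω} local = ⊆-antisym ⊆Ω ⊇Ω
    where
    ⊆Ω : image f Ω ⊆ Ω
    ⊆Ω t∈ with ∈-image⁻ t∈
    ... | s , s∈Ω , refl with local s∈Ω
    ...   | B , s∈B , fixed = p∩q⊆p Ω B (subst (f s ∈_) fixed (∈-image⁺ (x∈p∩q⁺ (s∈Ω , s∈B))))
    ⊇Ω : Ω ⊆ image f Ω
    ⊇Ω t∈Ω with local t∈Ω
    ... | B , t∈B , fixed with ∈-image⁻ (subst (_ ∈_) (sym fixed) (x∈p∩q⁺ (t∈Ω , t∈B)))
    ...   | s , s∈Ω∩B , refl = ∈-image⁺ (p∩q⊆p Ω B s∈Ω∩B)

  _·_ : ℕ → Z → Z
  zero · h = 0ᶻ
  suc k · h = h +ᶻ (k · h)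

  ⟨⟩-· : ∀ {Ω h} k → ⟨ Ω ⟩ h → ⟨ Ω ⟩ (k · h)
  ⟨⟩-· zero _ = ⟨0⟩
  ⟨⟩-· (suc k) h∈ = ⟨+⟩ h∈ (⟨⟩-· k h∈)

  toℕ-· : ∀ k h → toℕ (k · h) ≡ (k * toℕ h) % N
  toℕ-· zero h = toℕ-[] 0
  toℕ-· (suc k) h = begin
    toℕ (h +ᶻ (k · h))                   ≡⟨ toℕ-[] _ ⟩
    (toℕ h + toℕ (k · h)) % N            ≡⟨ cong (λ a → (toℕ h + a) % N) (toℕ-· k h) ⟩
    (toℕ h + (k * toℕ h) % N) % N        ≡⟨ %-distribˡ-+ (toℕ h) _ N ⟩
    (toℕ h % N + (k * toℕ h) % N % N) % N ≡⟨ cong (λ a → (toℕ h % N + a) % N) (m%n%n≡m%n _ N) ⟩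
    (toℕ h % N + (k * toℕ h) % N) % N     ≡⟨ %-distribˡ-+ (toℕ h) (k * toℕ h) N ⟨
    (toℕ h + k * toℕ h) % N              ∎
    where open ≡-Reasoning

  ⟨⟩-one⇒Generates : ∀ {Ω e} → ⟨ Ω ⟩ e → toℕ e ≡ 1 → Generates Ω
  ⟨⟩-one⇒Generates {Ω} {e} e∈ e≡1 t = subst ⟨ Ω ⟩ t·e≡t (⟨⟩-· (toℕ t) e∈)
    where
    t·e≡t : toℕ t · e ≡ t
    t·e≡t = toℕ-injective (begin
      toℕ (toℕ t · e)        ≡⟨ toℕ-· (toℕ t) e ⟩
      (toℕ t * toℕ e) % N    ≡⟨ cong (λ a → (toℕ t * a) % N) e≡1 ⟩
      (toℕ t * 1) % N        ≡⟨ cong (_% N) (*-identityʳ (toℕ t)) ⟩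
      toℕ t % N              ≡⟨ m<n⇒m%n≡m (toℕ<n t) ⟩
      toℕ t                  ∎)
      where open ≡-Reasoning

  ⟨⟩-∣ : ∀ {d Ω} → d ∣ N → (∀ {s} → s ∈ Ω → d ∣ toℕ s) → ∀ {t} → ⟨ Ω ⟩ t → d ∣ toℕ t
  ⟨⟩-∣ d∣N d∣Ω ⟨0⟩ = subst (_ ∣_) (sym toℕ-0ᶻ) (_ ∣0)
  ⟨⟩-∣ d∣N d∣Ω (⟨gen⟩ s∈Ω) = d∣Ω s∈Ω
  ⟨⟩-∣ d∣N d∣Ω (⟨+⟩ a∈ b∈) = subst (_ ∣_) (sym (toℕ-[] _))
    (%-presˡ-∣ (∣m∣n⇒∣m+n (⟨⟩-∣ d∣N d∣Ω a∈) (⟨⟩-∣ d∣N d∣Ω b∈)) d∣N)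
  ⟨⟩-∣ d∣N d∣Ω (⟨-⟩ {a} a∈) = subst (_ ∣_) (sym (toℕ-[] _))
    (%-presˡ-∣ (∣m∣n⇒∣n∸m (<⇒≤ (toℕ<n a)) (⟨⟩-∣ d∣N d∣Ω a∈) d∣N) d∣N)

  module _ (m≥1 : 1 ≤ m) where

    1<N : 1 < N
    1<N = ≤-trans (1<p pr) (subst (_≤ N) (*-identityʳ p) (^-monoʳ-≤ p {{prime⇒nonZero pr}} m≥1))

    toℕ-[1] : toℕ [ 1 ] ≡ 1
    toℕ-[1] = trans (toℕ-[] 1) (m<n⇒m%n≡m 1<N)

    p∣N : p ∣ N
    p∣N = subst (λ k → p ∣ p ^ k) (m+[n∸m]≡n m≥1) (m∣m*n (p ^ (m ∸ 1)))

    -- Bézout yields x with x s ≡ 1 or x s ≡ -1 modulo N; either way 1 ∈ ⟨ Ω ⟩.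
    unit⇒Generates : ∀ {Ω s} → s ∈ Ω → gcdᴺ s ≡ 1 → Generates Ω
    unit⇒Generates {Ω} {s} s∈Ω gcd≡1 with coprime-Bézout (gcd≡1⇒coprime gcd≡1)
    ... | Bézout.+- x y 1+yN≡xs = ⟨⟩-one⇒Generates (⟨⟩-· x (⟨gen⟩ s∈Ω)) (begin
      toℕ (x · s)           ≡⟨ toℕ-· x s ⟩
      (x * toℕ s) % N       ≡⟨ cong (_% N) 1+yN≡xs ⟨
      (1 + y * N) % N       ≡⟨ [m+kn]%n≡m%n 1 y N ⟩
      1 % N                 ≡⟨ m<n⇒m%n≡m 1<N ⟩
      1                     ∎)
      where open ≡-Reasoning
    ... | Bézout.-+ x y 1+xs≡yN = ⟨⟩-one⇒Generates (⟨-⟩ (⟨⟩-· x (⟨gen⟩ s∈Ω))) (begin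
      toℕ (-ᶻ (x · s))           ≡⟨ toℕ-[] _ ⟩
      (N ∸ toℕ (x · s)) % N      ≡⟨ cong (λ a → (N ∸ a) % N) (trans (toℕ-· x s) xs≡N∸1) ⟩
      (N ∸ (N ∸ 1)) % N          ≡⟨ cong (_% N) (m∸[m∸n]≡n (<⇒≤ 1<N)) ⟩
      1 % N                      ≡⟨ m<n⇒m%n≡m 1<N ⟩
      1                          ∎)
      where
      open ≡-Reasoning
      xs≡N∸1 : (x * toℕ s) % N ≡ N ∸ 1
      xs≡N∸1 = %-pred-≡0 (trans (cong (_% N) 1+xs≡yN) (m*n%n≡0 y N))

    Generates⇒unit : ∀ {Ω} → Generates Ω → Nonempty (Ω ∩ A 0)
    Generates⇒unit {Ω} gen with nonempty? (Ω ∩ A 0)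
    ... | yes unit = unit
    ... | no no-unit = ⊥-elim (<-irrefl p≡1 (1<p pr))
      where
      p∣Ω : ∀ {s} → s ∈ Ω → p ∣ toℕ s
      p∣Ω {s} s∈Ω with ∃∈A s
      ... | zero , _ , s∈A0 = ⊥-elim (no-unit (s , x∈p∩q⁺ (s∈Ω , s∈A0)))
      ... | suc k , _ , s∈A[1+k] =
        ∣-trans (m∣m*n (p ^ k))
                (subst (_∣ toℕ s) (Equivalence.to (∈A⇔ (suc k)) s∈A[1+k]) (gcd[m,n]∣m (toℕ s) N))
      p≡1 : 1 ≡ p
      p≡1 = sym (∣1⇒≡1 (subst (p ∣_) toℕ-[1] (⟨⟩-∣ p∣N p∣Ω (gen [ 1 ]))))

    nonzero : Subset N
    nonzero = ∁ ⁅ 0ᶻ ⁆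

    nonzero-∃∈A : ∀ {s} → s ∈ nonzero → ∃ λ k → k < m × s ∈ A k
    nonzero-∃∈A {s} s≢0 with ∃∈A s
    ... | k , k≤m , s∈Ak with m≤n⇒m<n∨m≡n k≤m
    ...   | inj₁ k<m = k , k<m , s∈Ak
    ...   | inj₂ refl =
      ⊥-elim (x∈∁p⇒x∉p s≢0 (subst (_∈ ⁅ 0ᶻ ⁆) (sym (∈A[m]⇒≡0ᶻ s∈Ak)) (x∈⁅x⁆ 0ᶻ)))

    nonzero∩A : ∀ {k} → k < m → nonzero ∩ A k ≡ A k
    nonzero∩A {k} k<m =
      ⊆-antisym (p∩q⊆q nonzero (A k)) (λ s∈Ak → x∈p∩q⁺ (x∉p⇒x∈∁p (s≢0 s∈Ak) , s∈Ak))
      where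
      s≢0 : ∀ {s} → s ∈ A k → s ∉ ⁅ 0ᶻ ⁆
      s≢0 s∈Ak s∈⁅0⁆ =
        <-irrefl (A-disjoint (subst (_∈ A k) (x∈⁅y⁆⇒x≡y 0ᶻ s∈⁅0⁆) s∈Ak) 0ᶻ∈A[m]) k<m

    module _ {u : ℕ} (u⊥N : Coprime u N) where

      Block : ℕ → Pred (Subset N) 0ℓ
      Block zero S = XFixPred u 0 S
      Block (suc k) S = Empty S ⊎ XFixPred u (suc k) S

      block? : ∀ k → Decidable (Block k)
      block? zero S = xfix? u 0 S
      block? (suc k) S = empty? S ⊎-dec xfix? u (suc k) S

      FixPred⇒Block : ∀ {Ω} → FixPred u Ω → ∀ k → Block k (Ω ∩ A k)
      FixPred⇒Block {Ω} (symmetric , _ , generates , invariant) = block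
        where
        fixed : ∀ k → Ω ∩ A k ⊆ A k × Symmetric (Ω ∩ A k) × image (mulᶻ u) (Ω ∩ A k) ≡ Ω ∩ A k
        fixed k = p∩q⊆q Ω (A k) , image-fixed-∩A gcdᴺ-neg symmetric k
                                , image-fixed-∩A (gcdᴺ-mul u⊥N) invariant k
        block : ∀ k → Block k (Ω ∩ A k)
        block zero = Generates⇒unit generates , fixed 0
        block (suc k) with nonempty? (Ω ∩ A (suc k))
        ... | yes nonempty = inj₂ (nonempty , fixed (suc k))
        ... | no empty = inj₁ empty

      Block⇒fixed : ∀ k {S} → Block k S → Symmetric S × image (mulᶻ u) S ≡ S
      Block⇒fixed zero (_ , _ , fixed) = fixed
      Block⇒fixed (suc k) (inj₁ empty) = image-Empty empty , image-Empty empty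
      Block⇒fixed (suc k) (inj₂ (_ , _ , fixed)) = fixed

      FixPred⇔Blocks : ∀ {Ω} → Ω ⊆ nonzero → FixPred u Ω ⇔ All (λ k → Block k (Ω ∩ A k)) (upTo m)
      FixPred⇔Blocks {Ω} Ω⊆nonzero = mk⇔
        (λ fix → All.tabulate (λ {k} _ → FixPred⇒Block fix k))
        (λ blocks → glue (proj₁ ∘ fixed blocks) , 0ᶻ∉Ω , generates blocks , glue (proj₂ ∘ fixed blocks))
        where
        fixed : All (λ k → Block k (Ω ∩ A k)) (upTo m) → ∀ {k} → k < m →
                Symmetric (Ω ∩ A k) × image (mulᶻ u) (Ω ∩ A k) ≡ Ω ∩ A k
        fixed blocks {k} k<m = Block⇒fixed k (All.lookup blocks (∈-upTo⁺ k<m))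
        glue : ∀ {f} → (∀ {k} → k < m → image f (Ω ∩ A k) ≡ Ω ∩ A k) → image f Ω ≡ Ω
        glue fixed-at = image-fixed-glue (λ s∈Ω → let k , k<m , s∈Ak = nonzero-∃∈A (Ω⊆nonzero s∈Ω) in
                                                  A k , s∈Ak , fixed-at k<m)
        0ᶻ∉Ω : 0ᶻ ∉ Ω
        0ᶻ∉Ω 0∈Ω = x∈∁p⇒x∉p (Ω⊆nonzero 0∈Ω) (x∈⁅x⁆ 0ᶻ)
        generates : All (λ k → Block k (Ω ∩ A k)) (upTo m) → Generates Ω
        generates blocks with All.lookup blocks (∈-upTo⁺ m≥1)
        ... | (s , s∈Ω∩A0) , _ =
          unit⇒Generates (p∩q⊆p Ω (A 0) s∈Ω∩A0) (Equivalence.to (∈A⇔ 0) (p∩q⊆q Ω (A 0) s∈Ω∩A0))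

      module _ (gen? : Decidable Generates) (x : ℕ) where

        blockGF : ℕ → ℕ
        blockGF k = ∑[ S ⊆ nonzero ∩ A k ] (𝟙 (block? k S) * x ^ ∣ S ∣)

        GF-FixPred≡product-blockGF : GF (FixPred u) (fix? u gen?) x ≡ product (map blockGF (upTo m))
        GF-FixPred≡product-blockGF = begin
          GF (FixPred u) (fix? u gen?) x
            ≡⟨ GF≡∑⊆ (fix? u gen?) x ⟩
          ∑[ Ω ⊆ ⊤ ] (𝟙 (fix? u gen? Ω) * x ^ ∣ Ω ∣)
            ≡⟨ ∑⊆≡∑⊆⊤ nonzero _ vanishes-off-nonzero ⟨
          ∑[ Ω ⊆ nonzero ] (𝟙 (fix? u gen? Ω) * x ^ ∣ Ω ∣)
            ≡⟨ GF-factorisation (upTo⁺ m) covers (fix? u gen?) block? FixPred⇔Blocks x ⟩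
          product (map blockGF (upTo m)) ∎
          where
          open ≡-Reasoning
          open Partition A A-disjoint
          vanishes-off-nonzero : ∀ Ω → ¬ Ω ⊆ nonzero → 𝟙 (fix? u gen? Ω) * x ^ ∣ Ω ∣ ≡ 0
          vanishes-off-nonzero Ω Ω⊈nonzero =
            cong (_* x ^ ∣ Ω ∣) (𝟙-no (fix? u gen? Ω) (Ω⊈nonzero ∘ FixPred⇒⊆nonzero))
            where
            FixPred⇒⊆nonzero : FixPred u Ω → Ω ⊆ nonzero
            FixPred⇒⊆nonzero (_ , 0ᶻ∉Ω , _) s∈Ω =
              x∉p⇒x∈∁p (λ s∈⁅0⁆ → 0ᶻ∉Ω (subst (_∈ Ω) (x∈⁅y⁆⇒x≡y 0ᶻ s∈⁅0⁆) s∈Ω))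
          covers : Covers nonzero (upTo m)
          covers s∈ = let k , k<m , s∈Ak = nonzero-∃∈A s∈ in lose (∈-upTo⁺ k<m) s∈Ak

        ∑⊆A-xfix≡GF : ∀ k → ∑[ S ⊆ A k ] (𝟙 (xfix? u k S) * x ^ ∣ S ∣) ≡ GF (XFixPred u k) (xfix? u k) x
        ∑⊆A-xfix≡GF k = trans (∑⊆≡∑⊆⊤ (A k) _ vanishes-off-A) (sym (GF≡∑⊆ (xfix? u k) x))
          where
          vanishes-off-A : ∀ S → ¬ S ⊆ A k → 𝟙 (xfix? u k S) * x ^ ∣ S ∣ ≡ 0
          vanishes-off-A S S⊈Ak = cong (_* x ^ ∣ S ∣) (𝟙-no (xfix? u k S) (λ (_ , S⊆Ak , _) → S⊈Ak S⊆Ak))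

        blockGF-zero : blockGF 0 ≡ GF (XFixPred u 0) (xfix? u 0) x
        blockGF-zero =
          trans (cong (λ T → ∑[ S ⊆ T ] (𝟙 (xfix? u 0 S) * x ^ ∣ S ∣)) (nonzero∩A m≥1)) (∑⊆A-xfix≡GF 0)

        blockGF-suc : ∀ {k} → suc k < m → blockGF (suc k) ≡ 1 + GF (XFixPred u (suc k)) (xfix? u (suc k)) x
        blockGF-suc {k} 1+k<m = begin
          ∑[ S ⊆ nonzero ∩ A (suc k) ] (𝟙 (block? (suc k) S) * x ^ ∣ S ∣)
            ≡⟨ cong (λ T → ∑[ S ⊆ T ] (𝟙 (block? (suc k) S) * x ^ ∣ S ∣)) (nonzero∩A 1+k<m) ⟩
          ∑[ S ⊆ A (suc k) ] (𝟙 (block? (suc k) S) * x ^ ∣ S ∣)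
            ≡⟨ ∑⊆-cong (A (suc k)) (λ {S} _ → split S) ⟩
          ∑[ S ⊆ A (suc k) ] (𝟙 (empty? S) * x ^ ∣ S ∣ + 𝟙 (xfix? u (suc k) S) * x ^ ∣ S ∣)
            ≡⟨ ∑⊆-+ (A (suc k)) _ _ ⟩
          ∑[ S ⊆ A (suc k) ] (𝟙 (empty? S) * x ^ ∣ S ∣)
            + ∑[ S ⊆ A (suc k) ] (𝟙 (xfix? u (suc k) S) * x ^ ∣ S ∣)
            ≡⟨ cong₂ _+_ (∑⊆-𝟙-Empty (A (suc k)) (λ S → x ^ ∣ S ∣)) (∑⊆A-xfix≡GF (suc k)) ⟩
          x ^ ∣ ⊥ {N} ∣ + GF (XFixPred u (suc k)) (xfix? u (suc k)) x
            ≡⟨ cong (λ e → x ^ e + GF (XFixPred u (suc k)) (xfix? u (suc k)) x) (∣⊥∣≡0 N) ⟩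
          1 + GF (XFixPred u (suc k)) (xfix? u (suc k)) x ∎
          where
          open ≡-Reasoning
          split : ∀ S → 𝟙 (block? (suc k) S) * x ^ ∣ S ∣
                          ≡ 𝟙 (empty? S) * x ^ ∣ S ∣ + 𝟙 (xfix? u (suc k) S) * x ^ ∣ S ∣
          split S = trans
            (cong (_* x ^ ∣ S ∣) (𝟙-⊎ (empty? S) (xfix? u (suc k) S) (λ (empty , nonempty , _) → empty nonempty)))
            (*-distribʳ-+ (x ^ ∣ S ∣) (𝟙 (empty? S)) (𝟙 (xfix? u (suc k) S)))

lemma4p1 : (p m : ℕ) (pr : Prime p) → 1 ≤ m →
    (u : Fin (p ^ m)) → Coprime (toℕ u) (p ^ m) →
    (gen? : ∀ Ω → Dec (Zpm.Generates p m pr Ω)) → (x : ℕ) →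
    GF (Zpm.FixPred p m pr (toℕ u)) (Zpm.fix? p m pr (toℕ u) gen?) x
      ≡ GF (Zpm.XFixPred p m pr (toℕ u) 0) (Zpm.xfix? p m pr (toℕ u) 0) x
        * product (map (λ k → 1 + GF (Zpm.XFixPred p m pr (toℕ u) k) (Zpm.xfix? p m pr (toℕ u) k) x)
                       (map suc (upTo (m ∸ 1))))
lemma4p1 _ zero _ () _ _ _ _
lemma4p1 p (suc c) pr m≥1 u u⊥N gen? x = begin
  GF (FixPred (toℕ u)) (fix? (toℕ u) gen?) x
    ≡⟨ GF-FixPred≡product-blockGF p (suc c) pr m≥1 u⊥N gen? x ⟩
  F 0 * product (map F (applyUpTo suc c))
    ≡⟨ cong (λ ks → F 0 * product (map F ks)) (map-upTo suc c) ⟨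
  F 0 * product (map F (map suc (upTo c)))
    ≡⟨ cong₂ _*_ (blockGF-zero p (suc c) pr m≥1 u⊥N gen? x)
                 (cong product (map-cong-local (All.map⁺ (All.tabulate
                   (λ i∈upTo → blockGF-suc p (suc c) pr m≥1 u⊥N gen? x (s≤s (∈-upTo⁻ i∈upTo))))))) ⟩
  GFX 0 * product (map (λ k → 1 + GFX k) (map suc (upTo c))) ∎
  where
  open ≡-Reasoning
  open Zpm p (suc c) pr
  F : ℕ → ℕ
  F = blockGF p (suc c) pr m≥1 u⊥N gen? x
  GFX : ℕ → ℕ
  GFX k = GF (XFixPred (toℕ u) k) (xfix? (toℕ u) k) x
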